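{- Let $n\ge d\ge 2$ be integers. The maximum diameter of strongly connected $(d-1)$-complexes on $[n]$ is attained at a corridor (hence at a pseudomanifold). In particular, \[ H_{\mathrm{s}}(n,d) < \frac{1}{d-1}\binom{n}{d-1} - 1. \]
   Context: A pure simplicial complex of dimension $d-1$ (a $(d-1)$-complex) on $[n]=\{1,\dots,n\}$ is a nonempty family $C$ of $d$-element subsets of $[n]$, called facets; $(d-1)$-element subsets of facets are ridges. Its adjacency (dual) graph $G(C)$ has the facets as vertices, two facets $X,Y$ being adjacent when $|X\setminus Y|=1$ (i.e. they share a ridge). $C$ is strongly connected if $G(C)$ is connected; its diameter is the diameter of $G(C)$. $H_{\mathrm{s}}(n,d)$ denotes the maximum diameter of strongly connected $(d-1)$-complexes on $[n]$. A corridor is a complex whose adjacency graph is a path. A pseudomanifold is a complex in which every ridge is contained in at most two facets. -}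

module Defs where

open import Data.Nat using (ℕ; zero; suc; _≤_; _<_; _∸_; _*_; _+_)
open import Data.Fin using (Fin; toℕ)
open import Data.Fin.Subset using (Subset; ∣_∣; _∩_; ∁; _⊆_)
open import Data.List using (List; []; length; lookup)
open import Data.List.Membership.Propositional using (_∈_)
open import Data.List.Relation.Unary.All using (All)
open import Data.List.Relation.Unary.Unique.Propositional using (Unique)
open import Data.List.Relation.Binary.Permutation.Propositional using (_↭_)
open import Data.Product using (Σ; ∃; _×_; _,_)
open import Data.Sum using (_⊎_)
open import Relation.Binary.PropositionalEquality using (_≡_; _≢_)
open import Relation.Nullary using (¬_)
open import Function.Bundles using (_⇔_)

-- A facet/face is a subset of [n] = Fin n.
-- A pure (d-1)-complex on [n]: a nonempty, duplicate-free list of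
-- d-element subsets of [n] (the list represents the finite family of facets).
record IsComplex (n d : ℕ) (C : List (Subset n)) : Set where
  field
    nonempty  : C ≢ []
    distinct  : Unique C
    facetSize : All (λ X → ∣ X ∣ ≡ d) C

Adj : ∀ {n} → Subset n → Subset n → Set
Adj X Y = ∣ X ∩ ∁ Y ∣ ≡ 1

data Walk {n} (C : List (Subset n)) : Subset n → Subset n → ℕ → Set where
  here : ∀ {X} → X ∈ C → Walk C X X zero
  step : ∀ {X Y Z m} → X ∈ C → Adj X Y → Walk C Y Z m → Walk C X Z (suc m)

StronglyConnected : ∀ {n} → List (Subset n) → Set
StronglyConnected C = ∀ X Y → X ∈ C → Y ∈ C → ∃ λ m → Walk C X Y m

HasDiameter : ∀ {n} → List (Subset n) → ℕ → Set
HasDiameter C k =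
  (∀ X Y → X ∈ C → Y ∈ C → ∃ λ m → m ≤ k × Walk C X Y m)
  × (∃ λ X → ∃ λ Y → X ∈ C × Y ∈ C × (∀ m → Walk C X Y m → k ≤ m))

IsCorridor : ∀ {n} → List (Subset n) → Set
IsCorridor C = Σ _ λ L → (L ↭ C) ×
  (∀ (i j : Fin (length L)) →
     Adj (lookup L i) (lookup L j) ⇔ (toℕ i ≡ suc (toℕ j) ⊎ toℕ j ≡ suc (toℕ i)))

-- Pseudomanifold: every ridge ((d-1)-subset) lies in at most two facets,
-- i.e. no ridge lies in three pairwise distinct facets.
IsPseudomanifold : ∀ {n} → ℕ → List (Subset n) → Set
IsPseudomanifold {n} d C = ∀ (R : Subset n) → ∣ R ∣ ≡ d ∸ 1 →
  ∀ X Y Z → X ∈ C → Y ∈ C → Z ∈ C → R ⊆ X → R ⊆ Y → R ⊆ Z →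
  X ≢ Y → Y ≢ Z → X ≢ Z → ⊥'
  where open import Data.Empty using () renaming (⊥ to ⊥')

-- A shortest walk between two facets at maximal distance has neither chords nor repeated facets,
-- so its facets form a corridor of the same diameter; a corridor is a pseudomanifold because three
-- facets through a common ridge would be pairwise adjacent. Along a corridor X₀, …, X_k each X_{i+1}
-- has d − 1 ridges besides X_i ∩ X_{i+1}, and none of them lies in an earlier facet, which would
-- otherwise be adjacent to X_{i+1}. Hence the corridor has at least d + k(d − 1) > (d − 1)(k + 1)
-- distinct ridges, all among the C(n, d − 1) subsets of size d − 1. This bounds the length of
-- corridors, and as the existence of a corridor of a given length is decidable, a longest one exists.
module Submission where

open import Data.Bool using (Bool; true; false)
import Data.Bool as Bool
open import Data.Empty using (⊥; ⊥-elim)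
open import Data.Fin using (Fin; toℕ)
open import Data.Fin.Properties using (toℕ<n)
open import Data.Fin.Subset using (Subset; ∣_∣; _∩_; ∁; _⊆_) renaming (⊥ to ∅)
open import Data.Fin.Subset.Properties
  using (drop-∷-⊆; p⊆q⇒∣p∣≤∣q∣; x∈p∩q⁺; p∩q⊆p; p∩q⊆q; ∩-comm; ∩-inverseʳ; ∣⊥∣≡0; anySubset?)
open import Data.List using (List; []; _∷_; length; map; filter; _++_; applyUpTo)
open import Data.List.Properties
  using (length-map; length-++; length-applyUpTo; lookup-applyUpTo; filter-accept; filter-reject; filter-all)
open import Data.List.Membership.Propositional using (_∈_)
open import Data.List.Membership.Propositional.Properties
  using (∈-map⁻; ∈-++⁻; ∈-filter⁻; ∈-applyUpTo⁺; ∈-applyUpTo⁻)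
open import Data.List.Relation.Binary.Permutation.Propositional using (↭-refl)
open import Data.List.Relation.Unary.All as All using (All; []; _∷_)
open import Data.List.Relation.Unary.Any using (here; there)
open import Data.List.Relation.Unary.Unique.Propositional using (Unique; []; _∷_)
import Data.List.Relation.Unary.Unique.Propositional.Properties as Unique
open import Data.Nat
open import Data.Nat.Properties
open import Data.Nat.Combinatorics using (_C_; nCk+nC[k+1]≡[n+1]C[k+1])
open import Data.Product using (Σ; ∃; _×_; _,_; proj₁; proj₂)
open import Data.Sum using (_⊎_; inj₁; inj₂; [_,_]′)
open import Data.Vec using (Vec; []; _∷_; here; there; tabulate)
open import Data.Vec.Properties using (∷-injectiveʳ; ≡-dec)
open import Function.Base using (_∘_)
open import Function.Bundles using (_⇔_; mk⇔; Equivalence)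
open import Relation.Binary.Definitions using (DecidableEquality; tri<; tri≈; tri>)
open import Relation.Binary.PropositionalEquality
open import Relation.Nullary using (¬_; Dec; yes; no; ¬?)
open import Relation.Nullary.Decidable using (map′; _×-dec_; _⊎-dec_; _→-dec_)

open import Defs

length≤1+length-filter-≢ : ∀ {a} {A : Set a} (_≟_ : DecidableEquality A) (x : A) {L : List A} →
                           Unique L → length L ≤ suc (length (filter (λ y → ¬? (y ≟ x)) L))
length≤1+length-filter-≢ _≟_ x {[]}    []           = z≤n
length≤1+length-filter-≢ _≟_ x {y ∷ L} (y∉L ∷ uniq) = by-cases (y ≟ x)
  where
  open ≤-Reasoning
  ≢x? = λ z → ¬? (z ≟ x)
  by-cases : Dec (y ≡ x) → length (y ∷ L) ≤ suc (length (filter ≢x? (y ∷ L)))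
  by-cases (yes refl) = begin
    suc (length L)                    ≡⟨ cong (suc ∘ length) (filter-all ≢x? (All.map ≢-sym y∉L)) ⟨
    suc (length (filter ≢x? L))       ≡⟨ cong (suc ∘ length) (filter-reject ≢x? (λ y≢y → y≢y refl)) ⟨
    suc (length (filter ≢x? (y ∷ L))) ∎
  by-cases (no y≢x) = begin
    suc (length L)                    ≤⟨ s≤s (length≤1+length-filter-≢ _≟_ x uniq) ⟩
    suc (suc (length (filter ≢x? L))) ≡⟨ cong (suc ∘ length) (filter-accept ≢x? y≢x) ⟨
    suc (length (filter ≢x? (y ∷ L))) ∎

∣p∩q∣+∣p∩∁q∣≡∣p∣ : ∀ {n} (p q : Subset n) → ∣ p ∩ q ∣ + ∣ p ∩ ∁ q ∣ ≡ ∣ p ∣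
∣p∩q∣+∣p∩∁q∣≡∣p∣ []          []          = refl
∣p∩q∣+∣p∩∁q∣≡∣p∣ (true ∷ p)  (true ∷ q)  = cong suc (∣p∩q∣+∣p∩∁q∣≡∣p∣ p q)
∣p∩q∣+∣p∩∁q∣≡∣p∣ (true ∷ p)  (false ∷ q) = trans (+-suc _ _) (cong suc (∣p∩q∣+∣p∩∁q∣≡∣p∣ p q))
∣p∩q∣+∣p∩∁q∣≡∣p∣ (false ∷ p) (_ ∷ q)     = ∣p∩q∣+∣p∩∁q∣≡∣p∣ p q

p⊆q∧∣p∣≡∣q∣⇒p≡q : ∀ {n} {p q : Subset n} → p ⊆ q → ∣ p ∣ ≡ ∣ q ∣ → p ≡ q
p⊆q∧∣p∣≡∣q∣⇒p≡q {p = []}        {[]}        _   _ = refl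
p⊆q∧∣p∣≡∣q∣⇒p≡q {p = true ∷ p}  {true ∷ q}  p⊆q e =
  cong (true ∷_) (p⊆q∧∣p∣≡∣q∣⇒p≡q (drop-∷-⊆ p⊆q) (suc-injective e))
p⊆q∧∣p∣≡∣q∣⇒p≡q {p = true ∷ p}  {false ∷ q} p⊆q _ with p⊆q here
... | ()
p⊆q∧∣p∣≡∣q∣⇒p≡q {p = false ∷ p} {true ∷ q}  p⊆q e =
  ⊥-elim (<⇒≢ (s≤s (p⊆q⇒∣p∣≤∣q∣ (drop-∷-⊆ p⊆q))) e)
p⊆q∧∣p∣≡∣q∣⇒p≡q {p = false ∷ p} {false ∷ q} p⊆q e =
  cong (false ∷_) (p⊆q∧∣p∣≡∣q∣⇒p≡q (drop-∷-⊆ p⊆q) e)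

∣p∩∁p∣≡0 : ∀ {n} (p : Subset n) → ∣ p ∩ ∁ p ∣ ≡ 0
∣p∩∁p∣≡0 {n} p = trans (cong ∣_∣ (∩-inverseʳ p)) (∣⊥∣≡0 n)

_≟ˢ_ : ∀ {n} → DecidableEquality (Subset n)
_≟ˢ_ = ≡-dec Bool._≟_

tailsWith : ∀ {n} → Bool → List (Subset (suc n)) → List (Subset n)
tailsWith b []            = []
tailsWith b ((c ∷ p) ∷ L) with c Bool.≟ b
... | yes _ = p ∷ tailsWith b L
... | no  _ = tailsWith b L

length-tailsWith : ∀ {n} (L : List (Subset (suc n))) →
                   length L ≡ length (tailsWith false L) + length (tailsWith true L)
length-tailsWith []                = refl
length-tailsWith ((false ∷ p) ∷ L) = cong suc (length-tailsWith L)
length-tailsWith ((true ∷ p) ∷ L)  = trans (cong suc (length-tailsWith L)) (sym (+-suc _ _))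

∈-tailsWith⁻ : ∀ {n} b (L : List (Subset (suc n))) {p} → p ∈ tailsWith b L → (b ∷ p) ∈ L
∈-tailsWith⁻ b ((c ∷ q) ∷ L) p∈ with c Bool.≟ b | p∈
... | yes refl | here refl = here refl
... | yes refl | there p∈  = there (∈-tailsWith⁻ b L p∈)
... | no  _    | p∈        = there (∈-tailsWith⁻ b L p∈)

tailsWith-unique : ∀ {n} b (L : List (Subset (suc n))) → Unique L → Unique (tailsWith b L)
tailsWith-unique b []            []          = []
tailsWith-unique b ((c ∷ q) ∷ L) (q∉ ∷ uniq) with c Bool.≟ b
... | yes refl = All.tabulate (λ p∈ q≡p → All.lookup q∉ (∈-tailsWith⁻ b L p∈) (cong (b ∷_) q≡p))
                 ∷ tailsWith-unique b L uniq
... | no  _    = tailsWith-unique b L uniq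

tailsWith-size : ∀ {n r} b (L : List (Subset (suc n))) → All (λ p → ∣ p ∣ ≡ r) L →
                 All (λ p → ∣ b ∷ p ∣ ≡ r) (tailsWith b L)
tailsWith-size b L sizes = All.tabulate (λ p∈ → All.lookup sizes (∈-tailsWith⁻ b L p∈))

unique⇒length≤C : ∀ n r (L : List (Subset n)) → Unique L → All (λ p → ∣ p ∣ ≡ r) L → length L ≤ n C r
unique⇒length≤C zero    zero    []            _                 _        = z≤n
unique⇒length≤C zero    zero    ([] ∷ [])     _                 _        = ≤-refl
unique⇒length≤C zero    zero    ([] ∷ [] ∷ _) (([]≢[] ∷ _) ∷ _) _        = ⊥-elim ([]≢[] refl)
unique⇒length≤C zero    (suc r) []            _                 _        = z≤n
unique⇒length≤C zero    (suc r) ([] ∷ _)      _                 (() ∷ _)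
unique⇒length≤C (suc n) zero    L             uniq              sizes    = begin
  length L                 ≡⟨ length-tailsWith L ⟩
  length L₀ + length L₁    ≡⟨ cong (length L₀ +_) (no-tails (tailsWith-size true L sizes)) ⟩
  length L₀ + 0            ≡⟨ +-identityʳ _ ⟩
  length L₀                ≤⟨ unique⇒length≤C n zero L₀ (tailsWith-unique false L uniq)
                                                            (tailsWith-size false L sizes) ⟩
  n C 0                    ∎
  where
  open ≤-Reasoning
  L₀ = tailsWith false L
  L₁ = tailsWith true L
  no-tails : ∀ {M : List (Subset n)} → All (λ p → suc ∣ p ∣ ≡ 0) M → length M ≡ 0
  no-tails []      = refl
  no-tails (() ∷ _)
unique⇒length≤C (suc n) (suc r) L             uniq              sizes    = begin
  length L                 ≡⟨ length-tailsWith L ⟩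
  length L₀ + length L₁    ≤⟨ +-mono-≤ (unique⇒length≤C n (suc r) L₀ (tailsWith-unique false L uniq) sizes₀)
                                       (unique⇒length≤C n r L₁ (tailsWith-unique true L uniq) sizes₁) ⟩
  n C suc r + n C r        ≡⟨ +-comm (n C suc r) _ ⟩
  n C r + n C suc r        ≡⟨ nCk+nC[k+1]≡[n+1]C[k+1] n r ⟩
  suc n C suc r            ∎
  where
  open ≤-Reasoning
  L₀ = tailsWith false L
  L₁ = tailsWith true L
  sizes₀ = tailsWith-size false L sizes
  sizes₁ = All.map suc-injective (tailsWith-size true L sizes)

¬Adj-refl : ∀ {n} (X : Subset n) → ¬ Adj X X
¬Adj-refl X adj = 0≢1+n (trans (sym (∣p∩∁p∣≡0 X)) adj)

module _ {n e : ℕ} (X Y : Subset n) (∣X∣≡1+e : ∣ X ∣ ≡ suc e) where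

  Adj⇒∣∩∣≡ : Adj X Y → ∣ X ∩ Y ∣ ≡ e
  Adj⇒∣∩∣≡ adj = suc-injective (begin
    suc ∣ X ∩ Y ∣             ≡⟨ +-comm 1 _ ⟩
    ∣ X ∩ Y ∣ + 1             ≡⟨ cong (∣ X ∩ Y ∣ +_) adj ⟨
    ∣ X ∩ Y ∣ + ∣ X ∩ ∁ Y ∣   ≡⟨ ∣p∩q∣+∣p∩∁q∣≡∣p∣ X Y ⟩
    ∣ X ∣                     ≡⟨ ∣X∣≡1+e ⟩
    suc e                     ∎)
    where open ≡-Reasoning

  ∣∩∣≡⇒Adj : ∣ X ∩ Y ∣ ≡ e → Adj X Y
  ∣∩∣≡⇒Adj ∣X∩Y∣≡e = +-cancelˡ-≡ e _ _ (begin
    e + ∣ X ∩ ∁ Y ∣           ≡⟨ cong (_+ ∣ X ∩ ∁ Y ∣) ∣X∩Y∣≡e ⟨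
    ∣ X ∩ Y ∣ + ∣ X ∩ ∁ Y ∣   ≡⟨ ∣p∩q∣+∣p∩∁q∣≡∣p∣ X Y ⟩
    ∣ X ∣                     ≡⟨ ∣X∣≡1+e ⟩
    suc e                     ≡⟨ +-comm 1 e ⟩
    e + 1                     ∎)
    where open ≡-Reasoning

Adj-sym : ∀ {n e} (X Y : Subset n) → ∣ X ∣ ≡ suc e → ∣ Y ∣ ≡ suc e → Adj X Y → Adj Y X
Adj-sym X Y ∣X∣≡1+e ∣Y∣≡1+e adj =
  ∣∩∣≡⇒Adj Y X ∣Y∣≡1+e (trans (cong ∣_∣ (∩-comm Y X)) (Adj⇒∣∩∣≡ X Y ∣X∣≡1+e adj))

module _ {n e : ℕ} (R X Y : Subset n) (∣X∣≡1+e : ∣ X ∣ ≡ suc e) (∣Y∣≡1+e : ∣ Y ∣ ≡ suc e)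
         (X≢Y : X ≢ Y) (∣R∣≡e : ∣ R ∣ ≡ e) (R⊆X : R ⊆ X) (R⊆Y : R ⊆ Y) where

  sharedRidge≡∩ : R ≡ X ∩ Y
  sharedRidge≡∩ = p⊆q∧∣p∣≡∣q∣⇒p≡q R⊆X∩Y (≤-antisym (p⊆q⇒∣p∣≤∣q∣ R⊆X∩Y) ∣X∩Y∣≤∣R∣)
    where
    R⊆X∩Y : R ⊆ X ∩ Y
    R⊆X∩Y x∈R = x∈p∩q⁺ (R⊆X x∈R , R⊆Y x∈R)
    ∣X∩Y∣≢∣X∣ : ∣ X ∩ Y ∣ ≢ ∣ X ∣
    ∣X∩Y∣≢∣X∣ eq = X≢Y (trans (sym (p⊆q∧∣p∣≡∣q∣⇒p≡q (p∩q⊆p X Y) eq))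
                              (p⊆q∧∣p∣≡∣q∣⇒p≡q (p∩q⊆q X Y) (trans eq (trans ∣X∣≡1+e (sym ∣Y∣≡1+e)))))
    ∣X∩Y∣≤∣R∣ : ∣ X ∩ Y ∣ ≤ ∣ R ∣
    ∣X∩Y∣≤∣R∣ = subst (∣ X ∩ Y ∣ ≤_) (sym ∣R∣≡e)
      (≤-pred (subst (∣ X ∩ Y ∣ <_) ∣X∣≡1+e (≤∧≢⇒< (p⊆q⇒∣p∣≤∣q∣ (p∩q⊆p X Y)) ∣X∩Y∣≢∣X∣)))

  sharedRidge⇒Adj : Adj X Y
  sharedRidge⇒Adj = ∣∩∣≡⇒Adj X Y ∣X∣≡1+e (trans (cong ∣_∣ (sym sharedRidge≡∩)) ∣R∣≡e)

ridges : ∀ {n} → Subset n → List (Subset n)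
ridges []          = []
ridges (true ∷ p)  = (false ∷ p) ∷ map (true ∷_) (ridges p)
ridges (false ∷ p) = map (false ∷_) (ridges p)

length-ridges : ∀ {n} (p : Subset n) → length (ridges p) ≡ ∣ p ∣
length-ridges []          = refl
length-ridges (true ∷ p)  = cong suc (trans (length-map _ (ridges p)) (length-ridges p))
length-ridges (false ∷ p) = trans (length-map _ (ridges p)) (length-ridges p)

∈-ridges⁻ : ∀ {n} {R : Subset n} p → R ∈ ridges p → R ⊆ p × suc ∣ R ∣ ≡ ∣ p ∣
∈-ridges⁻ (true ∷ p)  (here refl) = (λ { (there x∈p) → there x∈p }) , refl
∈-ridges⁻ (true ∷ p)  (there R∈) with ∈-map⁻ (true ∷_) R∈
... | R , R∈ridges , refl with ∈-ridges⁻ p R∈ridges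
...   | R⊆p , ∣R∣<∣p∣ = (λ { here → here ; (there x∈R) → there (R⊆p x∈R) }) , cong suc ∣R∣<∣p∣
∈-ridges⁻ (false ∷ p) R∈ with ∈-map⁻ (false ∷_) R∈
... | R , R∈ridges , refl with ∈-ridges⁻ p R∈ridges
...   | R⊆p , ∣R∣<∣p∣ = (λ { (there x∈R) → there (R⊆p x∈R) }) , ∣R∣<∣p∣

ridges-unique : ∀ {n} (p : Subset n) → Unique (ridges p)
ridges-unique []          = []
ridges-unique (true ∷ p)  =
  All.tabulate (λ R∈ → head-differs (∈-map⁻ (true ∷_) R∈)) ∷ Unique.map⁺ ∷-injectiveʳ (ridges-unique p)
  where
  head-differs : ∀ {R} → (∃ λ R′ → R′ ∈ ridges p × R ≡ true ∷ R′) → false ∷ p ≢ R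
  head-differs (_ , _ , refl) ()
ridges-unique (false ∷ p) = Unique.map⁺ ∷-injectiveʳ (ridges-unique p)

Consecutive : ℕ → ℕ → Set
Consecutive i j = i ≡ suc j ⊎ j ≡ suc i

consecutive-triangle-free : ∀ {a b c} → Consecutive a b → Consecutive b c → ¬ Consecutive a c
consecutive-triangle-free (inj₁ refl) (inj₁ refl) (inj₁ ())
consecutive-triangle-free (inj₁ refl) (inj₁ refl) (inj₂ ())
consecutive-triangle-free (inj₁ refl) (inj₂ refl) (inj₁ ())
consecutive-triangle-free (inj₁ refl) (inj₂ refl) (inj₂ ())
consecutive-triangle-free (inj₂ refl) (inj₁ refl) (inj₁ ())
consecutive-triangle-free (inj₂ refl) (inj₁ refl) (inj₂ ())
consecutive-triangle-free (inj₂ refl) (inj₂ refl) (inj₁ ())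
consecutive-triangle-free (inj₂ refl) (inj₂ refl) (inj₂ ())

consecutive⇒≤suc : ∀ {i j} → Consecutive i j → j ≤ suc i
consecutive⇒≤suc {j = j} (inj₁ refl) = ≤-trans (n≤1+n j) (n≤1+n (suc j))
consecutive⇒≤suc         (inj₂ refl) = ≤-refl

-- The paper's corridors, presented by the sequence f 0, …, f k of their facets.
record IsInducedPath {n} (d : ℕ) (f : ℕ → Subset n) (k : ℕ) : Set where
  field
    size                 : ∀ {i} → i ≤ k → ∣ f i ∣ ≡ d
    adjacent⇔consecutive : ∀ {i j} → i ≤ k → j ≤ k → Adj (f i) (f j) ⇔ Consecutive i j
    injective            : ∀ {i j} → i ≤ k → j ≤ k → f i ≡ f j → i ≡ j

  adjacent-suc : ∀ {i} → i < k → Adj (f i) (f (suc i))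
  adjacent-suc i<k = Equivalence.from (adjacent⇔consecutive (<⇒≤ i<k) i<k) (inj₂ refl)

HasInducedPath : ℕ → ℕ → ℕ → Set
HasInducedPath n d k = ∃ λ (f : ℕ → Subset n) → IsInducedPath d f k

newRidges : ∀ {n} → (ℕ → Subset n) → ℕ → List (Subset n)
newRidges f j = filter (λ R → ¬? (R ≟ˢ (f j ∩ f (suc j)))) (ridges (f (suc j)))

ridgesUpTo : ∀ {n} → (ℕ → Subset n) → ℕ → List (Subset n)
ridgesUpTo f zero    = ridges (f 0)
ridgesUpTo f (suc j) = newRidges f j ++ ridgesUpTo f j

∈-ridgesUpTo⁻ : ∀ {n} (f : ℕ → Subset n) j {R} → R ∈ ridgesUpTo f j → ∃ λ i → i ≤ j × R ∈ ridges (f i)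
∈-ridgesUpTo⁻ f zero    R∈ = 0 , z≤n , R∈
∈-ridgesUpTo⁻ f (suc j) R∈ with ∈-++⁻ (newRidges f j) R∈
... | inj₁ R∈new = suc j , ≤-refl , proj₁ (∈-filter⁻ _ R∈new)
... | inj₂ R∈old = let i , i≤j , R∈ridges = ∈-ridgesUpTo⁻ f j R∈old in i , m≤n⇒m≤1+n i≤j , R∈ridges

module _ {n e k : ℕ} {f : ℕ → Subset n} (path : IsInducedPath (suc e) f k) where
  open IsInducedPath path

  ridge-size : ∀ {i R} → i ≤ k → R ∈ ridges (f i) → ∣ R ∣ ≡ e
  ridge-size {i} i≤k R∈ = suc-injective (trans (proj₂ (∈-ridges⁻ (f i) R∈)) (size i≤k))

  ridgesUpTo-size : ∀ {j} → j ≤ k → All (λ R → ∣ R ∣ ≡ e) (ridgesUpTo f j)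
  ridgesUpTo-size {j} j≤k = All.tabulate λ R∈ →
    let i , i≤j , R∈ridges = ∈-ridgesUpTo⁻ f j R∈ in ridge-size (≤-trans i≤j j≤k) R∈ridges

  ridgesUpTo-length : ∀ {j} → j ≤ k → suc (e * suc j) ≤ length (ridgesUpTo f j)
  ridgesUpTo-length {zero}  _     = ≤-reflexive (begin
    suc (e * 1)            ≡⟨ cong suc (*-identityʳ e) ⟩
    suc e                  ≡⟨ size z≤n ⟨
    ∣ f 0 ∣                ≡⟨ length-ridges (f 0) ⟨
    length (ridges (f 0))  ∎)
    where open ≡-Reasoning
  ridgesUpTo-length {suc j} 1+j≤k = begin
    suc (e * suc (suc j))                            ≡⟨ cong suc (*-suc e (suc j)) ⟩
    suc (e + e * suc j)                              ≡⟨ +-suc e _ ⟨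
    e + suc (e * suc j)                              ≤⟨ +-mono-≤ e≤new (ridgesUpTo-length (<⇒≤ 1+j≤k)) ⟩
    length (newRidges f j) + length (ridgesUpTo f j) ≡⟨ length-++ (newRidges f j) ⟨
    length (ridgesUpTo f (suc j))                    ∎
    where
    open ≤-Reasoning
    e≤new : e ≤ length (newRidges f j)
    e≤new = ≤-pred (begin
      suc e                        ≡⟨ size 1+j≤k ⟨
      ∣ f (suc j) ∣                ≡⟨ length-ridges (f (suc j)) ⟨
      length (ridges (f (suc j)))  ≤⟨ length≤1+length-filter-≢ _≟ˢ_ _ (ridges-unique (f (suc j))) ⟩
      suc (length (newRidges f j)) ∎)

  -- A ridge of f (1 + j) lying in an earlier f i makes f i and f (1 + j) adjacent,
  -- so i = j and the ridge is f j ∩ f (1 + j), which newRidges leaves out.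
  ridgesUpTo-unique : ∀ {j} → j ≤ k → Unique (ridgesUpTo f j)
  ridgesUpTo-unique {zero}  _     = ridges-unique (f 0)
  ridgesUpTo-unique {suc j} 1+j≤k =
    Unique.++⁺ (Unique.filter⁺ _ (ridges-unique (f (suc j)))) (ridgesUpTo-unique (<⇒≤ 1+j≤k)) disjoint
    where
    disjoint : ∀ {R} → ¬ (R ∈ newRidges f j × R ∈ ridgesUpTo f j)
    disjoint {R} (R∈new , R∈old) with ∈-filter⁻ _ R∈new | ∈-ridgesUpTo⁻ f j R∈old
    ... | R∈ridges , R≢∩ | i , i≤j , R∈ridgesᵢ = by-cases (m≤n⇒m<n∨m≡n i≤j)
      where
      i≤k = ≤-trans i≤j (<⇒≤ 1+j≤k)
      ∣R∣≡e = ridge-size i≤k R∈ridgesᵢ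
      fᵢ≢f₁₊ⱼ : f i ≢ f (suc j)
      fᵢ≢f₁₊ⱼ fᵢ≡f₁₊ⱼ = <⇒≢ (s≤s i≤j) (injective i≤k 1+j≤k fᵢ≡f₁₊ⱼ)
      R≡∩ : R ≡ f i ∩ f (suc j)
      R≡∩ = sharedRidge≡∩ R (f i) (f (suc j)) (size i≤k) (size 1+j≤k) fᵢ≢f₁₊ⱼ ∣R∣≡e
              (proj₁ (∈-ridges⁻ _ R∈ridgesᵢ)) (proj₁ (∈-ridges⁻ _ R∈ridges))
      by-cases : i < j ⊎ i ≡ j → ⊥
      by-cases (inj₂ refl) = R≢∩ R≡∩
      by-cases (inj₁ i<j) with Equivalence.to (adjacent⇔consecutive i≤k 1+j≤k)
                                 (∣∩∣≡⇒Adj (f i) (f (suc j)) (size i≤k) (trans (cong ∣_∣ (sym R≡∩)) ∣R∣≡e))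
      ... | inj₁ refl = <⇒≱ i<j (m≤n+m j 2)
      ... | inj₂ refl = <-irrefl refl i<j

  ridge-count-bound : e * suc k < n C e
  ridge-count-bound = ≤-trans (ridgesUpTo-length ≤-refl)
    (unique⇒length≤C n e _ (ridgesUpTo-unique ≤-refl) (ridgesUpTo-size ≤-refl))

module _ {n : ℕ} {K : List (Subset n)} where

  _++ʷ_ : ∀ {X Y Z a b} → Walk K X Y a → Walk K Y Z b → Walk K X Z (a + b)
  here _        ++ʷ w′ = w′
  step X∈ adj w ++ʷ w′ = step X∈ adj (w ++ʷ w′)

  start-∈ : ∀ {X Y m} → Walk K X Y m → X ∈ K
  start-∈ (here X∈)     = X∈
  start-∈ (step X∈ _ _) = X∈

  AdjSymmetricOn : Set
  AdjSymmetricOn = ∀ {X Y} → X ∈ K → Y ∈ K → Adj X Y → Adj Y X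

  reverse-onto : ∀ {X Y Z m l} → AdjSymmetricOn → Walk K X Y m → Walk K X Z l → Walk K Y Z (m + l)
  reverse-onto         sym-adj (here _)                  acc = acc
  reverse-onto {l = l} sym-adj (step {m = m} X∈ adj w) acc = subst (Walk K _ _) (+-suc m l)
    (reverse-onto sym-adj w (step (start-∈ w) (sym-adj X∈ (start-∈ w) adj) acc))

  reverse : ∀ {X Y m} → AdjSymmetricOn → Walk K X Y m → Walk K Y X m
  reverse {m = m} sym-adj w = subst (Walk K _ _) (+-identityʳ m) (reverse-onto sym-adj w (here (start-∈ w)))

  walkAlong : ∀ (g : ℕ → Subset n) l → (∀ {i} → i ≤ l → g i ∈ K) →
              (∀ {i} → i < l → Adj (g i) (g (suc i))) → Walk K (g 0) (g l) l
  walkAlong g zero    g∈ _   = here (g∈ z≤n)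
  walkAlong g (suc l) g∈ adj =
    step (g∈ z≤n) (adj (s≤s z≤n)) (walkAlong (g ∘ suc) l (λ i≤l → g∈ (s≤s i≤l)) (λ i<l → adj (s≤s i<l)))

  vertex : ∀ {X Y m} → Walk K X Y m → ℕ → Subset n
  vertex (here {X} _)     _       = X
  vertex (step {X} _ _ _) zero    = X
  vertex (step _ _ w)     (suc i) = vertex w i

  vertex-∈ : ∀ {X Y m} (w : Walk K X Y m) i → vertex w i ∈ K
  vertex-∈ (here X∈)     _       = X∈
  vertex-∈ (step X∈ _ _) zero    = X∈
  vertex-∈ (step _ _ w)  (suc i) = vertex-∈ w i

  vertex-adjacent : ∀ {X Y m} (w : Walk K X Y m) {i} → i < m → Adj (vertex w i) (vertex w (suc i))
  vertex-adjacent (step _ adj (here _))     {zero}  _         = adj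
  vertex-adjacent (step _ adj (step _ _ _)) {zero}  _         = adj
  vertex-adjacent (step _ _ w)              {suc i} (s≤s i<m) = vertex-adjacent w i<m

  prefix : ∀ {X Y m} (w : Walk K X Y m) i → i ≤ m → Walk K X (vertex w i) i
  prefix (here X∈)       zero    _         = here X∈
  prefix (step X∈ _ _)   zero    _         = here X∈
  prefix (step X∈ adj w) (suc i) (s≤s i≤m) = step X∈ adj (prefix w i i≤m)

  suffix : ∀ {X Y m} (w : Walk K X Y m) j → j ≤ m → Walk K (vertex w j) Y (m ∸ j)
  suffix w@(here _)     zero    _         = w
  suffix w@(step _ _ _) zero    _         = w
  suffix (step _ _ w)   (suc j) (s≤s j≤m) = suffix w j j≤m

  IsShortest : ∀ {X Y m} → Walk K X Y m → Set
  IsShortest {X} {Y} {m} _ = ∀ m′ → Walk K X Y m′ → m ≤ m′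

  module _ {X Y m} (w : Walk K X Y m) (shortest : IsShortest w) where

    shortest-shortcut : ∀ {i j t} → i ≤ j → j ≤ m → Walk K (vertex w i) (vertex w j) t → j ≤ i + t
    shortest-shortcut {i} {j} {t} i≤j j≤m shortcut = +-cancelʳ-≤ (m ∸ j) j (i + t) (begin
      j + (m ∸ j)        ≡⟨ m+[n∸m]≡n j≤m ⟩
      m                  ≤⟨ shortest _ (prefix w i (≤-trans i≤j j≤m) ++ʷ (shortcut ++ʷ suffix w j j≤m)) ⟩
      i + (t + (m ∸ j))  ≡⟨ +-assoc i t (m ∸ j) ⟨
      i + t + (m ∸ j)    ∎)
      where open ≤-Reasoning

    shortest-chord : ∀ {i j} → i < j → j ≤ m → Adj (vertex w i) (vertex w j) → j ≡ suc i
    shortest-chord {i} {j} i<j j≤m adj = ≤-antisym (subst (j ≤_) (+-comm i 1)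
      (shortest-shortcut (<⇒≤ i<j) j≤m (step (vertex-∈ w i) adj (here (vertex-∈ w j))))) i<j

    shortest-no-repeat : ∀ {i j} → i < j → j ≤ m → vertex w i ≢ vertex w j
    shortest-no-repeat {i} {j} i<j j≤m wᵢ≡wⱼ = <⇒≱ i<j (subst (j ≤_) (+-identityʳ i)
      (shortest-shortcut (<⇒≤ i<j) j≤m (subst (λ Z → Walk K (vertex w i) Z 0) wᵢ≡wⱼ (here (vertex-∈ w i)))))

    shortest⇒IsInducedPath : ∀ {e} → All (λ X → ∣ X ∣ ≡ suc e) K → IsInducedPath (suc e) (vertex w) m
    shortest⇒IsInducedPath {e} sizes = record
      { size                 = λ {i} _ → size i
      ; adjacent⇔consecutive = λ i≤m j≤m → mk⇔ (adjacent⇒consecutive i≤m j≤m) (consecutive⇒adjacent i≤m j≤m)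
      ; injective            = injective
      }
      where
      f = vertex w
      size : ∀ i → ∣ f i ∣ ≡ suc e
      size i = All.lookup sizes (vertex-∈ w i)
      adjacent⇒consecutive : ∀ {i j} → i ≤ m → j ≤ m → Adj (f i) (f j) → Consecutive i j
      adjacent⇒consecutive {i} {j} i≤m j≤m adj with <-cmp i j
      ... | tri< i<j _ _  = inj₂ (shortest-chord i<j j≤m adj)
      ... | tri≈ _ refl _ = ⊥-elim (¬Adj-refl (f i) adj)
      ... | tri> _ _ j<i  = inj₁ (shortest-chord j<i i≤m (Adj-sym (f i) (f j) (size i) (size j) adj))
      consecutive⇒adjacent : ∀ {i j} → i ≤ m → j ≤ m → Consecutive i j → Adj (f i) (f j)
      consecutive⇒adjacent {j = j} i≤m _   (inj₁ refl) =
        Adj-sym (f j) (f (suc j)) (size j) (size (suc j)) (vertex-adjacent w i≤m)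
      consecutive⇒adjacent         _   j≤m (inj₂ refl) = vertex-adjacent w j≤m
      injective : ∀ {i j} → i ≤ m → j ≤ m → f i ≡ f j → i ≡ j
      injective {i} {j} i≤m j≤m fᵢ≡fⱼ with <-cmp i j
      ... | tri< i<j _ _ = ⊥-elim (shortest-no-repeat i<j j≤m fᵢ≡fⱼ)
      ... | tri≈ _ i≡j _ = i≡j
      ... | tri> _ _ j<i = ⊥-elim (shortest-no-repeat j<i i≤m (sym fᵢ≡fⱼ))

diameter⇒HasInducedPath : ∀ {n e k} {K : List (Subset n)} → IsComplex n (suc e) K → HasDiameter K k →
                          HasInducedPath n (suc e) k
diameter⇒HasInducedPath cx (close , X , Y , X∈ , Y∈ , far) with close X Y X∈ Y∈
... | m , m≤k , w with ≤-antisym m≤k (far m w)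
...   | refl = vertex w , shortest⇒IsInducedPath w far (IsComplex.facetSize cx)

module _ {n e k : ℕ} {f : ℕ → Subset n} (path : IsInducedPath (suc e) f k) where
  open IsInducedPath path

  facets : List (Subset n)
  facets = applyUpTo f (suc k)

  ∈-facets⁺ : ∀ {i} → i ≤ k → f i ∈ facets
  ∈-facets⁺ i≤k = ∈-applyUpTo⁺ f (s≤s i≤k)

  ∈-facets⁻ : ∀ {X} → X ∈ facets → ∃ λ i → i ≤ k × X ≡ f i
  ∈-facets⁻ X∈ = let i , i<1+k , X≡fᵢ = ∈-applyUpTo⁻ f X∈ in i , ≤-pred i<1+k , X≡fᵢ

  facet-size : ∀ {X} → X ∈ facets → ∣ X ∣ ≡ suc e
  facet-size X∈ with ∈-facets⁻ X∈
  ... | i , i≤k , refl = size i≤k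

  facets-isComplex : IsComplex n (suc e) facets
  facets-isComplex = record
    { nonempty  = λ ()
    ; distinct  = Unique.applyUpTo⁺₁ f (suc k) λ i<j j<1+k fᵢ≡fⱼ →
                    <⇒≢ i<j (injective (≤-pred (<-trans i<j j<1+k)) (≤-pred j<1+k) fᵢ≡fⱼ)
    ; facetSize = All.tabulate facet-size
    }

  facets-isCorridor : IsCorridor facets
  facets-isCorridor = facets , ↭-refl , λ i j →
    subst₂ (λ X Y → Adj X Y ⇔ Consecutive (toℕ i) (toℕ j))
           (sym (lookup-applyUpTo f (suc k) i)) (sym (lookup-applyUpTo f (suc k) j))
           (adjacent⇔consecutive (toℕ≤k i) (toℕ≤k j))
    where
    toℕ≤k : (i : Fin (length facets)) → toℕ i ≤ k
    toℕ≤k i = ≤-pred (subst (toℕ i <_) (length-applyUpTo f (suc k)) (toℕ<n i))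

  facets-isPseudomanifold : IsPseudomanifold (suc e) facets
  facets-isPseudomanifold R ∣R∣≡e X Y Z X∈ Y∈ Z∈ R⊆X R⊆Y R⊆Z X≢Y Y≢Z X≢Z
    with ∈-facets⁻ X∈ | ∈-facets⁻ Y∈ | ∈-facets⁻ Z∈
  ... | a , a≤k , refl | b , b≤k , refl | c , c≤k , refl =
    consecutive-triangle-free (consecutive a≤k b≤k R⊆X R⊆Y X≢Y)
                              (consecutive b≤k c≤k R⊆Y R⊆Z Y≢Z)
                              (consecutive a≤k c≤k R⊆X R⊆Z X≢Z)
    where
    consecutive : ∀ {i j} → i ≤ k → j ≤ k → R ⊆ f i → R ⊆ f j → f i ≢ f j → Consecutive i j
    consecutive i≤k j≤k R⊆fᵢ R⊆fⱼ fᵢ≢fⱼ = Equivalence.to (adjacent⇔consecutive i≤k j≤k)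
      (sharedRidge⇒Adj R _ _ (size i≤k) (size j≤k) fᵢ≢fⱼ ∣R∣≡e R⊆fᵢ R⊆fⱼ)

  walk-up : ∀ {a b} → a ≤ b → b ≤ k → Walk facets (f a) (f b) (b ∸ a)
  walk-up {a} {b} a≤b b≤k = subst (λ c → Walk facets (f a) (f c) (b ∸ a)) (m∸n+n≡m a≤b)
    (walkAlong (λ i → f (i + a)) (b ∸ a) (λ i≤ → ∈-facets⁺ (shifted≤k i≤))
                                          (λ i< → adjacent-suc (shifted≤k i<)))
    where
    shifted≤k : ∀ {i} → i ≤ b ∸ a → i + a ≤ k
    shifted≤k i≤ = ≤-trans (+-monoˡ-≤ a i≤) (≤-trans (≤-reflexive (m∸n+n≡m a≤b)) b≤k)

  facets-close : ∀ X Y → X ∈ facets → Y ∈ facets → ∃ λ m → m ≤ k × Walk facets X Y m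
  facets-close X Y X∈ Y∈ with ∈-facets⁻ X∈ | ∈-facets⁻ Y∈
  ... | a , a≤k , refl | b , b≤k , refl with ≤-total a b
  ...   | inj₁ a≤b = b ∸ a , ≤-trans (m∸n≤m b a) b≤k , walk-up a≤b b≤k
  ...   | inj₂ b≤a = a ∸ b , ≤-trans (m∸n≤m a b) a≤k ,
                     reverse (λ {X} {Y} X∈ Y∈ → Adj-sym X Y (facet-size X∈) (facet-size Y∈)) (walk-up b≤a a≤k)

  walk-length : ∀ {X Y m a b} → Walk facets X Y m → a ≤ k → b ≤ k → X ≡ f a → Y ≡ f b → b ≤ a + m
  walk-length {a = a} (here _) a≤k b≤k refl Y≡fb =
    ≤-reflexive (trans (injective b≤k a≤k (sym Y≡fb)) (sym (+-identityʳ a)))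
  walk-length {a = a} {b} (step {m = m} _ adj w) a≤k b≤k refl Y≡fb with ∈-facets⁻ (start-∈ w)
  ... | c , c≤k , refl = begin
    b          ≤⟨ walk-length w c≤k b≤k refl Y≡fb ⟩
    c + m      ≤⟨ +-monoˡ-≤ m (consecutive⇒≤suc (Equivalence.to (adjacent⇔consecutive a≤k c≤k) adj)) ⟩
    suc a + m  ≡⟨ +-suc a m ⟨
    a + suc m  ∎
    where open ≤-Reasoning

  facets-stronglyConnected : StronglyConnected facets
  facets-stronglyConnected X Y X∈ Y∈ = let m , _ , w = facets-close X Y X∈ Y∈ in m , w

  facets-hasDiameter : HasDiameter facets k
  facets-hasDiameter = facets-close , f 0 , f k , ∈-facets⁺ z≤n , ∈-facets⁺ ≤-refl ,
                       λ m w → walk-length w z≤n ≤-refl refl refl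

IsInducedPath-cong : ∀ {n d k} {f g : ℕ → Subset n} → (∀ {i} → i ≤ k → f i ≡ g i) →
                     IsInducedPath d f k → IsInducedPath d g k
IsInducedPath-cong f≗g path = record
  { size                 = λ i≤k → trans (cong ∣_∣ (sym (f≗g i≤k))) (size i≤k)
  ; adjacent⇔consecutive = λ i≤k j≤k →
      subst₂ (λ X Y → Adj X Y ⇔ _) (f≗g i≤k) (f≗g j≤k) (adjacent⇔consecutive i≤k j≤k)
  ; injective            = λ i≤k j≤k gᵢ≡gⱼ →
      injective i≤k j≤k (trans (f≗g i≤k) (trans gᵢ≡gⱼ (sym (f≗g j≤k))))
  }
  where open IsInducedPath path

all≤? : ∀ {P : ℕ → Set} → (∀ i → Dec (P i)) → ∀ k → Dec (∀ {i} → i ≤ k → P i)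
all≤? P? k = map′ (λ all< {i} i≤k → all< {i} (s≤s i≤k)) (λ all≤ {i} i<1+k → all≤ {i} (≤-pred i<1+k))
                  (allUpTo? P? (suc k))

all≤²? : ∀ {Q : ℕ → ℕ → Set} → (∀ i j → Dec (Q i j)) → ∀ k → Dec (∀ {i j} → i ≤ k → j ≤ k → Q i j)
all≤²? Q? k = map′ (λ all {i} {j} i≤k j≤k → all {i} i≤k {j} j≤k) (λ all {i} i≤k {j} j≤k → all {i} {j} i≤k j≤k)
                   (all≤? (λ i → all≤? (Q? i) k) k)

_⇔?_ : ∀ {A B : Set} → Dec A → Dec B → Dec (A ⇔ B)
A? ⇔? B? = map′ (λ (to , from) → mk⇔ to from) (λ A⇔B → Equivalence.to A⇔B , Equivalence.from A⇔B)
                ((A? →-dec B?) ×-dec (B? →-dec A?))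

IsInducedPath? : ∀ {n} d (f : ℕ → Subset n) k → Dec (IsInducedPath d f k)
IsInducedPath? d f k = map′
  (λ (size , adj , inj) → record { size = λ {i} → size {i} ; adjacent⇔consecutive = λ {i} {j} → adj {i} {j}
                                 ; injective = λ {i} {j} → inj {i} {j} })
  (λ path → let open IsInducedPath path in
            (λ {i} → size {i}) , (λ {i} {j} → adjacent⇔consecutive {i} {j}) , (λ {i} {j} → injective {i} {j}))
  (all≤? (λ i → ∣ f i ∣ ≟ d) k
   ×-dec all≤²? (λ i j → (∣ f i ∩ ∁ (f j) ∣ ≟ 1) ⇔? ((i ≟ suc j) ⊎-dec (j ≟ suc i))) k
   ×-dec all≤²? (λ i j → (f i ≟ˢ f j) →-dec (i ≟ j)) k)

Vec-search : ∀ {A : Set} → (∀ {Q : A → Set} → (∀ x → Dec (Q x)) → Dec (∃ Q)) →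
             ∀ m {P : Vec A m → Set} → (∀ v → Dec (P v)) → Dec (∃ P)
Vec-search search zero    P? = map′ ([] ,_) (λ { ([] , P[]) → P[] }) (P? [])
Vec-search search (suc m) P? = map′ (λ (x , v , Pxv) → x ∷ v , Pxv) (λ { (x ∷ v , Pxv) → x , v , Pxv })
                                    (search λ x → Vec-search search m (λ v → P? (x ∷ v)))

-- ∅ past the end is filler: only indices below the length are ever read.
nth : ∀ {n m} → Vec (Subset n) m → ℕ → Subset n
nth []      _       = ∅
nth (p ∷ _) zero    = p
nth (_ ∷ v) (suc i) = nth v i

nth-tabulate : ∀ {n} m (f : ℕ → Subset n) {i} → i < m → nth (tabulate {n = m} (f ∘ toℕ)) i ≡ f i
nth-tabulate (suc m) f {zero}  _         = refl
nth-tabulate (suc m) f {suc i} (s≤s i<m) = nth-tabulate m (f ∘ suc) i<m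

HasInducedPath? : ∀ n d k → Dec (HasInducedPath n d k)
HasInducedPath? n d k = map′
  (λ (v , path) → nth v , path)
  (λ (f , path) → tabulate (f ∘ toℕ)
                 , IsInducedPath-cong (λ i≤k → sym (nth-tabulate (suc k) f (s≤s i≤k))) path)
  (Vec-search anySubset? (suc k) (λ v → IsInducedPath? d (nth v) k))

maximum-below : ∀ {P : ℕ → Set} → (∀ j → Dec (P j)) → ∀ B {j} → j < B → P j →
                ∃ λ j* → P j* × (∀ {j} → j < B → P j → j ≤ j*)
maximum-below P? (suc B) {j} j<1+B Pj with P? B
... | yes PB = B , PB , λ j<1+B _ → ≤-pred j<1+B
... | no ¬PB with m≤n⇒m<n∨m≡n (≤-pred j<1+B)
...   | inj₂ refl = ⊥-elim (¬PB Pj)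
...   | inj₁ j<B  = let j* , Pj* , largest = maximum-below P? B j<B Pj in
  j* , Pj* , λ j′<1+B Pj′ → [ (λ j′<B → largest j′<B Pj′) , (λ { refl → ⊥-elim (¬PB Pj′) }) ]′
                              (m≤n⇒m<n∨m≡n (≤-pred j′<1+B))

subset-of-size : ∀ {n d} → d ≤ n → ∃ λ (p : Subset n) → ∣ p ∣ ≡ d
subset-of-size {n}     {zero}  _         = ∅ , ∣⊥∣≡0 n
subset-of-size {suc n} {suc d} (s≤s d≤n) = let p , ∣p∣≡d = subset-of-size d≤n in true ∷ p , cong suc ∣p∣≡d

single-facet : ∀ {n d} (p : Subset n) → ∣ p ∣ ≡ d → IsInducedPath d (λ _ → p) 0
single-facet p ∣p∣≡d = record
  { size                 = λ _ → ∣p∣≡d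
  ; adjacent⇔consecutive = λ { z≤n z≤n → mk⇔ (λ adj → ⊥-elim (¬Adj-refl p adj)) λ { (inj₁ ()) ; (inj₂ ()) } }
  ; injective            = λ { z≤n z≤n _ → refl }
  }

longest-inducedPath : ∀ {n e} → 2 + e ≤ n →
                      ∃ λ k → HasInducedPath n (2 + e) k × (∀ {j} → HasInducedPath n (2 + e) j → j ≤ k)
longest-inducedPath {n} {e} 2+e≤n =
  let p , ∣p∣≡2+e        = subset-of-size 2+e≤n
      facet              = _ , single-facet p ∣p∣≡2+e
      k , path , longest = maximum-below (HasInducedPath? n (2 + e)) (n C suc e) (below facet) facet
  in k , path , λ pathⱼ → longest (below pathⱼ) pathⱼ
  where
  below : ∀ {j} → HasInducedPath n (2 + e) j → j < n C suc e
  below {j} (_ , path) = ≤-trans (m≤n*m (suc j) (suc e)) (<⇒≤ (ridge-count-bound path))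

corollary2p7 : ∀ (n d : ℕ) → 2 ≤ d → d ≤ n →
    (Σ (List (Subset n)) λ K → IsComplex n d K × StronglyConnected K
        × IsCorridor K × IsPseudomanifold d K
        × (∃ λ k → HasDiameter K k
             × (∀ (K' : List (Subset n)) (k' : ℕ) → IsComplex n d K'
                  → StronglyConnected K' → HasDiameter K' k' → k' ≤ k)))
    × (∀ (K : List (Subset n)) (k : ℕ) → IsComplex n d K → StronglyConnected K
         → HasDiameter K k → (d ∸ 1) * suc k < n C (d ∸ 1))
corollary2p7 n (suc (suc e)) (s≤s (s≤s z≤n)) d≤n =
  let k , (_ , path) , longest = longest-inducedPath d≤n in
  ( facets path
  , facets-isComplex path
  , facets-stronglyConnected path
  , facets-isCorridor path
  , facets-isPseudomanifold path
  , k
  , facets-hasDiameter path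
  , λ K′ k′ cx _ diameter → longest (diameter⇒HasInducedPath cx diameter))
  , λ K k cx _ diameter → ridge-count-bound (proj₂ (diameter⇒HasInducedPath cx diameter))
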